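{- For every integer $a\geq 3$ and every integer $m\geq a^2-a+1$, the 2-color Rado number of the equation $x_1+x_2+\cdots+x_{m-1}=ax_m$ equals $C(m,a)=\left\lceil\frac{m-1}{a}\left\lceil\frac{m-1}{a}\right\rceil\right\rceil$.
   Context: For integers $m\ge 3$ and $a\ge 1$, the 2-color Rado number of $x_1+\cdots+x_{m-1}=ax_m$ is the least positive integer $n$ such that for every coloring of $[n]=\{1,\dots,n\}$ with two colors there exist $x_1,\dots,x_m\in[n]$ (not necessarily distinct), all of the same color, satisfying the equation. -}

module Defs where

open import Data.Nat using (ℕ; zero; suc; _+_; _*_; _∸_; _≤_; NonZero)
open import Data.Nat.DivMod using (_/_)
open import Data.Bool using (Bool)
open import Data.Fin using (Fin; inject₁; fromℕ)
open import Data.Product using (Σ; _×_; ∃)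
open import Relation.Binary.PropositionalEquality using (_≡_)

-- ceiling of p / q for natural numbers, q nonzero: ⌈p/q⌉ = ⌊(p + q - 1)/q⌋
-- (the value for q = 0 is an irrelevant convention; only q ≥ 3 is used)
ceilDiv : (p q : ℕ) → ℕ
ceilDiv p zero = 0
ceilDiv p (suc q) = (p + q) / suc q

sumFin : (k : ℕ) → (Fin k → ℕ) → ℕ
sumFin zero f = 0
sumFin (suc k) f = f Fin.zero + sumFin k (λ i → f (Fin.suc i))

-- The variables are indexed by Fin (suc k): indices 0..k-1 are x_1..x_{m-1},
-- index k (= fromℕ k) is x_m.
MonoSolution : (k a n : ℕ) → (ℕ → Bool) → Set
MonoSolution k a n χ =
  Σ (Fin (suc k) → ℕ) λ x →
    (∀ i → 1 ≤ x i) × (∀ i → x i ≤ n) ×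
    Σ Bool (λ col → ∀ i → χ (x i) ≡ col) ×
    (sumFin k (λ i → x (inject₁ i)) ≡ a * x (fromℕ k))

RadoProperty : (m a n : ℕ) → Set
RadoProperty m a n = (χ : ℕ → Bool) → MonoSolution (m ∸ 1) a n χ

IsRadoNumber : (m a n : ℕ) → Set
IsRadoNumber m a n =
  1 ≤ n × RadoProperty m a n × (∀ n′ → 1 ≤ n′ → RadoProperty m a n′ → n ≤ n′)

-- C(m,a) = ⌈ ((m-1)/a) · ⌈(m-1)/a⌉ ⌉ = ⌈ (m-1)·⌈(m-1)/a⌉ / a ⌉
C : (m a : ℕ) → ℕ
C m a = ceilDiv ((m ∸ 1) * ceilDiv (m ∸ 1) a) a

module Submission where

-- Write a = q + 1, k = m - 1, c = ⌈k/a⌉ and N = ⌈kc/a⌉ = C(m, a); the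
-- hypothesis on m says k ≥ a·q.  A monochromatic solution with x_m = y is a
-- representation of a·y as a sum of k numbers of the colour of y (SumOf,
-- toSolution).  The lower bound comes from colouring [1, c-1] and [c, ∞)
-- differently (lowerBound).  For the upper bound (UpperBound) let R be the
-- colour of 1 and split on the first t + 1 ≤ c of the other colour: none,
-- t + 1 = c, t + 1 < c with t ≥ 2, or t = 1 (then by the colours of 3, 4).
-- In each case a few chosen numbers either give a solution directly, via
-- interval-sums or sums-1-3-4, or have their colour forced, and the forced
-- colours combine into a solution.  The arithmetic rests on
-- p ≤ a·⌈p/a⌉ ≤ p + q and a few polynomial inequalities.

open import Defs
open import Data.Nat using (ℕ; zero; suc; _+_; _*_; _∸_; _≤_; _<_; z≤n; s≤s; _≤?_; _<ᵇ_)
open import Data.Nat.Properties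
open import Data.Nat.DivMod using (_%_; m≡m%n+[m/n]*n; m%n<n; m/n*n≤m)
open import Data.Nat.Tactic.RingSolver using (solve-∀)
open import Data.Bool using (Bool; true; false; not; T)
import Data.Bool as Bool
open import Data.Bool.Properties using (¬-not)
open import Data.Unit using (tt)
open import Data.Fin using (Fin; inject₁; fromℕ) renaming (zero to fz; suc to fs)
open import Data.Product using (Σ; _×_; _,_; proj₁; proj₂)
open import Data.Sum using (_⊎_; inj₁; inj₂; [_,_]′)
open import Data.Empty using (⊥; ⊥-elim)
open import Relation.Nullary using (yes; no)
open import Relation.Binary.PropositionalEquality

-- Ceiling division.  For a = suc q the defining property of ⌈p/a⌉ is
-- p ≤ a·⌈p/a⌉ ≤ p + q; everything below uses only these two bounds.

ceilDiv-upper : ∀ p q → suc q * ceilDiv p (suc q) ≤ p + q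
ceilDiv-upper p q = subst (_≤ p + q) (*-comm (ceilDiv p (suc q)) (suc q)) (m/n*n≤m (p + q) (suc q))

ceilDiv-lower : ∀ p q → p ≤ suc q * ceilDiv p (suc q)
ceilDiv-lower p q = +-cancelʳ-≤ q p _ (begin
  p + q                                 ≡⟨ m≡m%n+[m/n]*n (p + q) (suc q) ⟩
  (p + q) % suc q + ⌈p/a⌉ * suc q       ≤⟨ +-mono-≤ remainder≤q (≤-reflexive (*-comm ⌈p/a⌉ (suc q))) ⟩
  q + suc q * ⌈p/a⌉                     ≡⟨ +-comm q _ ⟩
  suc q * ⌈p/a⌉ + q                     ∎)
  where
    open ≤-Reasoning
    ⌈p/a⌉ : ℕ
    ⌈p/a⌉ = ceilDiv p (suc q)
    remainder≤q : (p + q) % suc q ≤ q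
    remainder≤q = ≤-pred (m%n<n (p + q) (suc q))

-- From a·(y+1) ≤ X + q one gets a·y < X: the slack q < a cannot absorb a whole a.
<-from-ceiling : ∀ q y X → suc q * suc y ≤ X + q → suc q * y < X
<-from-ceiling q y X h = +-cancelʳ-≤ q _ X (subst (_≤ X + q) unfold h)
  where
    unfold : suc q * suc y ≡ suc (suc q * y) + q
    unfold = trans (*-suc (suc q) y) (cong suc (+-comm q (suc q * y)))

cancel-with-slack : ∀ q x y → suc q * x ≤ suc q * y + q → x ≤ y
cancel-with-slack q x y h with x ≤? y
... | yes x≤y = x≤y
... | no x≰y = ⊥-elim (n≮n _ (<-from-ceiling q y (suc q * y) (≤-trans (*-monoʳ-≤ (suc q) (≰⇒> x≰y)) h)))

below-ceilDiv : ∀ q y X → suc y ≤ ceilDiv X (suc q) → suc q * y < X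
below-ceilDiv q y X h = <-from-ceiling q y X (≤-trans (*-monoʳ-≤ (suc q) h) (ceilDiv-upper X q))

·1≤ : ∀ {j s} → j ≤ s → j * 1 ≤ s
·1≤ {j} {s} = subst (_≤ s) (sym (*-identityʳ j))

∸-lower : ∀ a b s → a + b ≤ s → b ≤ s ∸ a
∸-lower a b s h = subst (_≤ s ∸ a) (m+n∸m≡n a b) (∸-monoˡ-≤ a h)

∸-upper : ∀ s a b → s ≤ a + b → s ∸ a ≤ b
∸-upper s a b h = subst (s ∸ a ≤_) (m+n∸m≡n a b) (∸-monoˡ-≤ a h)

halve : ∀ x y → x + x ≤ y + y → x ≤ y
halve x y h = *-cancelˡ-≤ 2 (subst₂ _≤_ (double x) (double y) h)
  where
    double : ∀ x → x + x ≡ 2 * x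
    double = solve-∀

parity : ∀ n → Σ ℕ (λ h → n ≡ h + h) ⊎ Σ ℕ (λ h → n ≡ suc (h + h))
parity zero = inj₁ (0 , refl)
parity (suc n) with parity n
... | inj₁ (h , n≡2h) = inj₂ (h , cong suc n≡2h)
... | inj₂ (h , n≡2h+1) = inj₁ (suc h , trans (cong suc n≡2h+1) (cong suc (sym (+-suc h h))))

-- SumOf P j s: s is a sum of j numbers (repetitions allowed), each satisfying P.
-- A monochromatic solution is exactly "a·y ∈ SumOf (colour of y) k".
data SumOf (P : ℕ → Set) : ℕ → ℕ → Set where
  nil  : SumOf P 0 0
  cons : ∀ {j s} x → P x → SumOf P j s → SumOf P (suc j) (x + s)

recast : ∀ {P j j′ s s′} → j ≡ j′ → s ≡ s′ → SumOf P j s → SumOf P j′ s′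
recast refl refl r = r

_++ₛ_ : ∀ {P j l s u} → SumOf P j s → SumOf P l u → SumOf P (j + l) (s + u)
nil ++ₛ r = r
_++ₛ_ {u = u} (cons {s = s} x px r₁) r₂ = recast refl (sym (+-assoc x s u)) (cons x px (r₁ ++ₛ r₂))

replicateₛ : ∀ {P x} → P x → ∀ j → SumOf P j (j * x)
replicateₛ px zero = nil
replicateₛ {x = x} px (suc j) = cons x px (replicateₛ px j)

-- If every number of the interval [u, v] satisfies P, then every s between j·u
-- and j·v is a sum of j of them (greedily take min(v, s - (j-1)·u) first).
interval-sums : ∀ {P} u v → (∀ z → u ≤ z → z ≤ v → P z) →
                ∀ j s → j * u ≤ s → s ≤ j * v → SumOf P j s
interval-sums u v inI zero s lo hi with hi
... | z≤n = nil
interval-sums u v inI (suc j) s lo hi with (s ∸ j * u) ≤? v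
... | yes rest≤v = recast refl (m∸n+n≡m ju≤s)
                     (cons (s ∸ j * u) (inI _ u≤rest rest≤v)
                       (interval-sums u v inI j (j * u) ≤-refl (*-monoʳ-≤ j (≤-trans u≤rest rest≤v))))
  where
    ju≤s : j * u ≤ s
    ju≤s = ≤-trans (m≤n+m (j * u) u) lo
    u≤rest : u ≤ s ∸ j * u
    u≤rest = ∸-lower (j * u) u s (subst (_≤ s) (+-comm u (j * u)) lo)
... | no rest≰v = recast refl (m+[n∸m]≡n v≤s)
                    (cons v (inI v u≤v ≤-refl) (interval-sums u v inI j (s ∸ v) lo′ hi′))
  where
    ju≤s : j * u ≤ s
    ju≤s = ≤-trans (m≤n+m (j * u) u) lo
    v≤rest : v ≤ s ∸ j * u
    v≤rest = <⇒≤ (≰⇒> rest≰v)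
    u≤v : u ≤ v
    u≤v = *-cancelˡ-≤ (suc j) (≤-trans lo hi)
    v≤s : v ≤ s
    v≤s = ≤-trans v≤rest (m∸n≤m s (j * u))
    lo′ : j * u ≤ s ∸ v
    lo′ = ∸-lower v (j * u) s (≤-trans (+-monoˡ-≤ (j * u) v≤rest) (≤-reflexive (m∸n+n≡m ju≤s)))
    hi′ : s ∸ v ≤ j * v
    hi′ = ∸-upper s v (j * v) hi

pair-interval : ∀ {P : ℕ → Set} {u} → P u → P (suc u) → ∀ z → u ≤ z → z ≤ suc u → P z
pair-interval {P} pu psu z u≤z z≤su with m≤n⇒m<n∨m≡n z≤su
... | inj₂ refl = psu
... | inj₁ z<su = subst P (≤-antisym u≤z (≤-pred z<su)) pu

sums-1-3 : ∀ {P} → P 1 → P 3 → ∀ j u → u ≤ j → SumOf P j (j + 2 * u)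
sums-1-3 p1 p3 j u u≤j =
  recast (m∸n+n≡m u≤j) (trans (regroup (j ∸ u) u) (cong (λ x → x + 2 * u) (m∸n+n≡m u≤j)))
         (replicateₛ p1 (j ∸ u) ++ₛ replicateₛ p3 u)
  where
    regroup : ∀ x u → x * 1 + u * 3 ≡ (x + u) + 2 * u
    regroup = solve-∀

-- Sums of k numbers from {1, 3, 4} fill the whole range [k + 2, 3k]: write
-- s = k + e; for even e use ones and threes only, for odd e ≥ 3 one four and
-- then ones and threes.
sums-1-3-4 : ∀ {P} → P 1 → P 3 → P 4 → ∀ k s → k + 2 ≤ s → s ≤ k * 3 → SumOf P k s
sums-1-3-4 p1 p3 p4 zero s 2≤s s≤0 = ⊥-elim (1+n≰n (≤-trans (≤-trans (s≤s z≤n) 2≤s) s≤0))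
sums-1-3-4 {P} p1 p3 p4 k@(suc j) s k+2≤s s≤3k = by-parity (parity e)
  where
    e : ℕ
    e = s ∸ k
    k+e≡s : k + e ≡ s
    k+e≡s = m+[n∸m]≡n (≤-trans (m≤m+n k 2) k+2≤s)
    e≤2k : e ≤ k + k
    e≤2k = ∸-upper s k (k + k) (≤-trans s≤3k (≤-reflexive (triple k)))
      where
        triple : ∀ k → k * 3 ≡ k + (k + k)
        triple = solve-∀
    e≥2 : 2 ≤ e
    e≥2 = ∸-lower k 2 s k+2≤s
    by-parity : Σ ℕ (λ u → e ≡ u + u) ⊎ Σ ℕ (λ u → e ≡ suc (u + u)) → SumOf P k s
    by-parity (inj₁ (u , e≡2u)) =
      recast refl (trans (cong (k +_) (trans (two-u u) (sym e≡2u))) k+e≡s)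
             (sums-1-3 p1 p3 k u (halve u k (subst (_≤ k + k) e≡2u e≤2k)))
      where
        two-u : ∀ u → 2 * u ≡ u + u
        two-u = solve-∀
    by-parity (inj₂ (zero , e≡1)) = ⊥-elim (1+n≰n (subst (2 ≤_) e≡1 e≥2))
    by-parity (inj₂ (suc u , e≡2u+3)) =
      recast refl (trans (regroup j u) (trans (cong (k +_) (sym e≡2u+3)) k+e≡s))
             (cons 4 p4 (sums-1-3 p1 p3 j u u≤j))
      where
        regroup : ∀ j u → 4 + (j + 2 * u) ≡ suc j + suc (suc u + suc u)
        regroup = solve-∀
        odd : ∀ u → suc (suc u + suc u) ≡ suc (suc (suc (u + u)))
        odd = solve-∀
        even : ∀ j → suc j + suc j ≡ suc (suc (j + j))
        even = solve-∀
        2u+3≤2j+2 : suc (suc u + suc u) ≤ suc j + suc j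
        2u+3≤2j+2 = subst (_≤ k + k) e≡2u+3 e≤2k
        u≤j : u ≤ j
        u≤j = halve u j (≤-trans (n≤1+n _) (≤-pred (≤-pred (subst₂ _≤_ (odd u) (even j) 2u+3≤2j+2))))

Coloured : ℕ → (ℕ → Bool) → Bool → ℕ → Set
Coloured n χ b x = (1 ≤ x) × (x ≤ n) × (χ x ≡ b)

terms : ∀ {P j s} → SumOf P j s → ℕ → Fin (suc j) → ℕ
terms nil y fz = y
terms (cons x _ r) y fz = x
terms (cons x _ r) y (fs i) = terms r y i

terms-all : ∀ {P j s y} (r : SumOf P j s) → P y → ∀ i → P (terms r y i)
terms-all nil py fz = py
terms-all (cons x px r) py fz = px
terms-all (cons x px r) py (fs i) = terms-all r py i

terms-last : ∀ {P j s} (r : SumOf P j s) y → terms r y (fromℕ j) ≡ y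
terms-last nil y = refl
terms-last (cons x px r) y = terms-last r y

terms-sum : ∀ {P j s} (r : SumOf P j s) y → sumFin j (λ i → terms r y (inject₁ i)) ≡ s
terms-sum nil y = refl
terms-sum (cons x px r) y = cong (x +_) (terms-sum r y)

toSolution : ∀ {n χ b k a y} → SumOf (Coloured n χ b) k (a * y) → Coloured n χ b y →
             MonoSolution k a n χ
toSolution {n} {χ} {b} {k} {a} {y} r cy =
  terms r y , (λ i → proj₁ (col i)) , (λ i → proj₁ (proj₂ (col i))) ,
  (b , λ i → proj₂ (proj₂ (col i))) , trans (terms-sum r y) (cong (a *_) (sym (terms-last r y)))
  where
    col : ∀ i → Coloured n χ b (terms r y i)
    col = terms-all r cy

FirstChange : (ℕ → Bool) → ℕ → Set
FirstChange χ u = Σ ℕ λ t → 1 ≤ t × suc t ≤ u × (∀ x → 1 ≤ x → x ≤ t → χ x ≡ χ 1) ×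
                              χ (suc t) ≡ not (χ 1)

constant-or-change : ∀ χ u → (∀ x → 1 ≤ x → x ≤ u → χ x ≡ χ 1) ⊎ FirstChange χ u
constant-or-change χ zero = inj₁ (λ x 1≤x x≤0 → ⊥-elim (1+n≰n (≤-trans 1≤x x≤0)))
constant-or-change χ (suc u) with constant-or-change χ u
... | inj₂ (t , t≥1 , t<u , same , flip) = inj₂ (t , t≥1 , m≤n⇒m≤1+n t<u , same , flip)
... | inj₁ same with χ (suc u) Bool.≟ χ 1
...   | yes same′ = inj₁ extended
  where
    extended : ∀ x → 1 ≤ x → x ≤ suc u → χ x ≡ χ 1
    extended x 1≤x x≤su with m≤n⇒m<n∨m≡n x≤su
    ... | inj₁ x<su = same x 1≤x (≤-pred x<su)
    ... | inj₂ refl = same′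
...   | no differ with u
...     | zero = ⊥-elim (differ refl)
...     | suc u′ = inj₂ (suc u′ , s≤s z≤n , ≤-refl , same , ¬-not differ)

sumFin-lower : ∀ k l f → (∀ i → l ≤ f i) → k * l ≤ sumFin k f
sumFin-lower zero l f h = z≤n
sumFin-lower (suc k) l f h = +-mono-≤ (h fz) (sumFin-lower k l (λ i → f (fs i)) (λ i → h (fs i)))

-- Lower bound: with c = ⌈k/a⌉, colour [1, c-1] true and [c, ∞) false.  A true
-- solution has k ≤ Σ xᵢ = a·y with y < c, impossible as a·(c-1) < k; a false
-- solution inside [1, n′] has k·c ≤ Σ xᵢ = a·y with y ≤ n′, so n′ ≥ ⌈kc/a⌉.
lowerBound : ∀ q k n′ → (∀ χ → MonoSolution k (suc q) n′ χ) →
             ceilDiv (k * ceilDiv k (suc q)) (suc q) ≤ n′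
lowerBound q k n′ H = ≮⇒≥ (λ n′<N → no-solution n′<N (H χ₀))
  where
    c : ℕ
    c = ceilDiv k (suc q)
    χ₀ : ℕ → Bool
    χ₀ x = x <ᵇ c
    sum≥ : ∀ l (x : Fin (suc k) → ℕ) {y} → (∀ i → l ≤ x (inject₁ i)) →
           sumFin k (λ i → x (inject₁ i)) ≡ suc q * y → k * l ≤ suc q * y
    sum≥ l x low eq = subst (k * l ≤_) eq (sumFin-lower k l _ low)
    no-solution : n′ < ceilDiv (k * c) (suc q) → MonoSolution k (suc q) n′ χ₀ → ⊥
    no-solution _ (x , x≥1 , _ , (true , col) , eq) =
      <⇒≱ (below-ceilDiv q y k (<ᵇ⇒< y c (subst T (sym (col (fromℕ k))) tt)))
          (subst (_≤ suc q * y) (*-identityʳ k) (sum≥ 1 x (λ i → x≥1 (inject₁ i)) eq))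
      where
        y : ℕ
        y = x (fromℕ k)
    no-solution n′<N (x , _ , x≤n′ , (false , col) , eq) =
      <⇒≱ (below-ceilDiv q y (k * c) (≤-trans (s≤s (x≤n′ (fromℕ k))) n′<N))
          (sum≥ c x (λ i → ≮⇒≥ (λ xᵢ<c → subst T (col (inject₁ i)) (<⇒<ᵇ xᵢ<c))) eq)
      where
        y : ℕ
        y = x (fromℕ k)

-- Each is
-- proved by shifting the variables to their lower bounds (q = 2 + y, …) and
-- exhibiting the difference of the two sides as a polynomial with nonnegative
-- coefficients (the slack), checked by the ring solver.

≤-by-slack : ∀ {x y} d → x + d ≡ y → x ≤ y
≤-by-slack {x} d refl = m≤m+n x d

at-least : ∀ (P : ℕ → Set) m → (∀ y → P (m + y)) → ∀ n → m ≤ n → P n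
at-least P m h n m≤n = subst P (m+[n∸m]≡n m≤n) (h (n ∸ m))

q+[1+q]≤[1+q]q : ∀ q → 2 ≤ q → q + suc q ≤ suc q * q
q+[1+q]≤[1+q]q = at-least (λ q → q + suc q ≤ suc q * q) 2 (λ y → ≤-by-slack _ (identity y))
  where
    identity : ∀ y → (2 + y) + suc (2 + y) + (1 + 3 * y + y * y) ≡ suc (2 + y) * (2 + y)
    identity = solve-∀

[1+t]²+2qt≤[1+q][1+t]t : ∀ q t → 2 ≤ q → 2 ≤ t → suc t * suc t + 2 * q * t ≤ suc q * suc t * t
[1+t]²+2qt≤[1+q][1+t]t q t q≥2 t≥2 =
  at-least (λ q → Goal q t) 2 (λ y → at-least (Goal (2 + y)) 2 (λ x → ≤-by-slack _ (identity y x)) t t≥2) q q≥2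
  where
    Goal : ℕ → ℕ → Set
    Goal q t = suc t * suc t + 2 * q * t ≤ suc q * suc t * t
    identity : ∀ y x → suc (2 + x) * suc (2 + x) + 2 * (2 + y) * (2 + x)
                         + (1 + 5 * x + 2 * x * x + x * x * y + 3 * x * y + 2 * y)
                       ≡ suc (2 + y) * suc (2 + x) * (2 + x)
    identity = solve-∀

[q+p][1+t]+[q+p]+q≤[1+q]pt : ∀ q p t → 2 ≤ q → 2 ≤ t → suc (suc q * t) ≤ p →
                             (q + p) * suc t + (q + p) + q ≤ suc q * (p * t)
[q+p][1+t]+[q+p]+q≤[1+q]pt q p t q≥2 t≥2 p≥ =
  at-least (λ q → ∀ t → 2 ≤ t → Hyp q t → Goal q t p) 2
    (λ y → at-least (λ t → Hyp (2 + y) t → Goal (2 + y) t p) 2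
             (λ w → at-least (Goal (2 + y) (2 + w)) (suc (suc (2 + y) * (2 + w)))
                      (λ e → ≤-by-slack _ (identity y w e)) p))
    q q≥2 t t≥2 p≥
  where
    Hyp : ℕ → ℕ → Set
    Hyp q t = suc (suc q * t) ≤ p
    Goal : ℕ → ℕ → ℕ → Set
    Goal q t p = (q + p) * suc t + (q + p) + q ≤ suc q * (p * t)
    identity : ∀ y w e → let p = suc (suc (2 + y) * (2 + w)) + e in
      ((2 + y) + p) * suc (2 + w) + ((2 + y) + p) + (2 + y)
        + (4 + 2 * e + 2 * e * w + e * w * y + 2 * e * y + 18 * w + 6 * w * w + 5 * w * w * y
           + w * w * y * y + 18 * w * y + 4 * w * y * y + 13 * y + 4 * y * y)
      ≡ suc (2 + y) * (p * (2 + w))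
    identity = solve-∀

from-q²≤p : ∀ (Goal : ℕ → ℕ → Set) → (∀ y e → Goal (2 + y) ((2 + y) * (2 + y) + e)) →
            ∀ q p → 2 ≤ q → q * q ≤ p → Goal q p
from-q²≤p Goal h q p q≥2 =
  at-least (λ q → q * q ≤ p → Goal q p) 2 (λ y → at-least (Goal (2 + y)) ((2 + y) * (2 + y)) (h y) p) q q≥2

p+2q+[1+q]q≤[1+q]2p : ∀ q p → 2 ≤ q → q * q ≤ p → p + 2 * q + suc q * q ≤ suc q * (2 * p)
p+2q+[1+q]q≤[1+q]2p =
  from-q²≤p (λ q p → p + 2 * q + suc q * q ≤ suc q * (2 * p)) (λ y e → ≤-by-slack _ (identity y e))
  where
    identity : ∀ y e → let q = 2 + y ; p = q * q + e in
      p + 2 * q + suc q * q + (10 + 5 * e + 2 * e * y + 21 * y + 12 * y * y + 2 * y * y * y) ≡ suc q * (2 * p)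
    identity = solve-∀

2[q+p]≤[1+q]p : ∀ q p → 2 ≤ q → q * q ≤ p → 2 * (q + p) ≤ suc q * p
2[q+p]≤[1+q]p = from-q²≤p (λ q p → 2 * (q + p) ≤ suc q * p) (λ y e → ≤-by-slack _ (identity y e))
  where
    identity : ∀ y e → let q = 2 + y ; p = q * q + e in
      2 * (q + p) + (e + e * y + 6 * y + 5 * y * y + y * y * y) ≡ suc q * p
    identity = solve-∀

[1+q]p+q[2[q+p]+q]+[1+q]q≤3[1+q][q+p] : ∀ q p → 2 ≤ q → q * q ≤ p →
  suc q * p + q * (2 * (q + p) + q) + suc q * q ≤ 3 * (suc q * (q + p))
[1+q]p+q[2[q+p]+q]+[1+q]q≤3[1+q][q+p] =
  from-q²≤p (λ q p → suc q * p + q * (2 * (q + p) + q) + suc q * q ≤ 3 * (suc q * (q + p)))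
            (λ y e → ≤-by-slack _ (identity y e))
  where
    identity : ∀ y e → let q = 2 + y ; p = q * q + e in
      suc q * p + q * (2 * (q + p) + q) + suc q * q + (8 + 2 * e + 6 * y + y * y) ≡ 3 * (suc q * (q + p))
    identity = solve-∀

module Setting (q k : ℕ) (q≥2 : 2 ≤ q) (aq≤k : suc q * q ≤ k) where

  a c N p : ℕ
  a = suc q
  c = ceilDiv k a
  N = ceilDiv (k * c) a
  p = k ∸ q

  k≤ac : k ≤ a * c
  k≤ac = ceilDiv-lower k q

  ac≤k+q : a * c ≤ k + q
  ac≤k+q = ceilDiv-upper k q

  kc≤aN : k * c ≤ a * N
  kc≤aN = ceilDiv-lower (k * c) q

  aN≤kc+q : a * N ≤ k * c + q
  aN≤kc+q = ceilDiv-upper (k * c) q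

  q+a≤k : q + a ≤ k
  q+a≤k = ≤-trans (q+[1+q]≤[1+q]q q q≥2) aq≤k

  a≤k : a ≤ k
  a≤k = ≤-trans (m≤n+m a q) q+a≤k

  q≤k : q ≤ k
  q≤k = ≤-trans (n≤1+n q) a≤k

  q+p≡k : q + p ≡ k
  q+p≡k = m+[n∸m]≡n q≤k

  q²≤p : q * q ≤ p
  q²≤p = +-cancelˡ-≤ q (q * q) p (subst (a * q ≤_) (sym q+p≡k) aq≤k)

  p≤k : p ≤ k
  p≤k = m∸n≤m k q

  q≤c : q ≤ c
  q≤c = *-cancelˡ-≤ a (≤-trans aq≤k k≤ac)

  c≥2 : 2 ≤ c
  c≥2 = ≤-trans q≥2 q≤c

  c≥1 : 1 ≤ c
  c≥1 = ≤-trans (s≤s z≤n) c≥2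

  c≤k : c ≤ k
  c≤k = cancel-with-slack q c k (≤-trans ac≤k+q (+-monoˡ-≤ q (m≤m+n k (q * k))))

  ≤N : ∀ x → a * x ≤ k * c → x ≤ N
  ≤N x ax≤kc = *-cancelˡ-≤ a (≤-trans ax≤kc kc≤aN)

  c≤N : c ≤ N
  c≤N = ≤N c (*-monoˡ-≤ c a≤k)

  N≥1 : 1 ≤ N
  N≥1 = ≤-trans c≥1 c≤N

  N≥2 : 2 ≤ N
  N≥2 = ≤-trans c≥2 c≤N

module UpperBound (q k : ℕ) (q≥2 : 2 ≤ q) (aq≤k : suc q * q ≤ k) (χ : ℕ → Bool) where

  open Setting q k q≥2 aq≤k

  R : Bool
  R = χ 1

  Red Blue : ℕ → Set
  Red = Coloured N χ R
  Blue = Coloured N χ (not R)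

  Sol : Set
  Sol = MonoSolution k a N χ

  solution : ∀ {b y} → SumOf (Coloured N χ b) k (a * y) → Coloured N χ b y → Sol
  solution {b} {y} = toSolution {N} {χ} {b} {k} {a} {y}

  colour : ∀ x → χ x ≡ R ⊎ χ x ≡ not R
  colour x with χ x Bool.≟ R
  ... | yes same = inj₁ same
  ... | no differ = inj₂ (¬-not differ)

  red1 : Red 1
  red1 = ≤-refl , N≥1 , refl

  InitialRed : ℕ → Set
  InitialRed t = ∀ x → 1 ≤ x → x ≤ t → χ x ≡ R

  run-red : ∀ {t} → InitialRed t → t ≤ N → ∀ z → 1 ≤ z → z ≤ t → Red z
  run-red run t≤N z 1≤z z≤t = 1≤z , ≤-trans z≤t t≤N , run z 1≤z z≤t

  -- Case A: [1, c] is red.  Then a·c ∈ [k, kc] is a sum of k numbers from [1, c].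
  allRed : InitialRed c → Sol
  allRed run = solution (interval-sums 1 c (run-red run c≤N) k (a * c) (·1≤ k≤ac) (*-monoˡ-≤ c a≤k))
                        (c≥1 , c≤N , run c c≥1 ≤-refl)

  module FirstBlueAtC (t : ℕ) (t≥2 : 2 ≤ t) (c≡t+1 : suc t ≡ c) (run : InitialRed t)
                      (blue-t+1 : χ (suc t) ≡ not R) where

    t≤c : t ≤ c
    t≤c = subst (t ≤_) c≡t+1 (n≤1+n t)

    red-run : ∀ z → 1 ≤ z → z ≤ t → Red z
    red-run = run-red run (≤-trans t≤c c≤N)

    blue-c : Blue c
    blue-c = c≥1 , c≤N , subst (λ x → χ x ≡ not R) c≡t+1 blue-t+1

    a[c+1]≤kt : a * suc c ≤ k * t
    a[c+1]≤kt = begin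
      a * suc c     ≡⟨ *-suc a c ⟩
      a + a * c     ≤⟨ +-monoʳ-≤ a ac≤k+q ⟩
      a + (k + q)   ≡⟨ rearrange a k q ⟩
      k + (q + a)   ≤⟨ +-monoʳ-≤ k q+a≤k ⟩
      k + k         ≡⟨ double k ⟩
      k * 2         ≤⟨ *-monoʳ-≤ k t≥2 ⟩
      k * t         ∎
      where
        open ≤-Reasoning
        rearrange : ∀ a k q → a + (k + q) ≡ k + (q + a)
        rearrange = solve-∀
        double : ∀ k → k + k ≡ k * 2
        double = solve-∀

    c+1≤N : suc c ≤ N
    c+1≤N = ≤N (suc c) (≤-trans a[c+1]≤kt (*-monoʳ-≤ k t≤c))

    -- p = k - q lies in [1, N]: a·p ≤ k·c.
    ap≤kc : a * p ≤ k * c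
    ap≤kc with a ≤? c
    ... | yes a≤c = ≤-trans (*-mono-≤ a≤c p≤k) (≤-reflexive (*-comm c k))
    ... | no a≰c = +-cancelʳ-≤ (a * q) (a * p) (k * c) (begin
        a * p + a * q   ≡⟨ trans (+-comm (a * p) (a * q)) (sym (*-distribˡ-+ a q p)) ⟩
        a * (q + p)     ≡⟨ trans (cong (a *_) q+p≡k) (*-comm a k) ⟩
        k * a           ≡⟨ *-suc k q ⟩
        k + k * q       ≤⟨ +-monoˡ-≤ (k * q) (subst (λ x → k ≤ a * x) c≡q k≤ac) ⟩
        a * q + k * q   ≡⟨ trans (+-comm (a * q) (k * q)) (cong (λ x → k * x + a * q) (sym c≡q)) ⟩
        k * c + a * q   ∎)
      where
        open ≤-Reasoning
        c≡q : c ≡ q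
        c≡q = ≤-antisym (≤-pred (≰⇒> a≰c)) q≤c

    N≤pt : N ≤ p * t
    N≤pt = ≤-trans N≤c² c²≤pt
      where
        N≤c² : N ≤ c * c
        N≤c² = cancel-with-slack q N (c * c)
                 (≤-trans aN≤kc+q (+-monoˡ-≤ q (≤-trans (*-monoˡ-≤ c k≤ac) (≤-reflexive (*-assoc a c c)))))
        ac≤p+2q : a * c ≤ p + 2 * q
        ac≤p+2q = ≤-trans ac≤k+q (≤-reflexive (trans (cong (_+ q) (sym q+p≡k)) (rearrange q p)))
          where
            rearrange : ∀ q p → q + p + q ≡ p + 2 * q
            rearrange = solve-∀
        c²≤pt : c * c ≤ p * t
        c²≤pt = +-cancelʳ-≤ (2 * q * t) (c * c) (p * t) (begin
          c * c + 2 * q * t   ≤⟨ subst (λ x → x * x + 2 * q * t ≤ a * x * t) c≡t+1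
                                   ([1+t]²+2qt≤[1+q][1+t]t q t q≥2 t≥2) ⟩
          a * c * t           ≤⟨ *-monoˡ-≤ t ac≤p+2q ⟩
          (p + 2 * q) * t     ≡⟨ *-distribʳ-+ t p (2 * q) ⟩
          p * t + 2 * q * t   ∎)
          where open ≤-Reasoning

    -- c + 1 red: a(c+1) ∈ [k, kt] is a sum of k numbers from the red run [1, t].
    red-c+1 : χ (suc c) ≡ R → Sol
    red-c+1 red = solution (interval-sums 1 t red-run k (a * suc c) (·1≤ k≤a[c+1]) a[c+1]≤kt)
                           (s≤s z≤n , c+1≤N , red)
      where
        k≤a[c+1] : k ≤ a * suc c
        k≤a[c+1] = ≤-trans k≤ac (*-monoʳ-≤ a (n≤1+n c))

    -- c, c + 1 and N blue: a·N ∈ [kc, k(c+1)] is a sum of k numbers from {c, c+1}.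
    blue-N : χ (suc c) ≡ not R → χ N ≡ not R → Sol
    blue-N blue-c+1 blue = solution (interval-sums c (suc c) blue-c,c+1 k (a * N) kc≤aN aN≤k[c+1])
                                    (N≥1 , ≤-refl , blue)
      where
        blue-c,c+1 : ∀ z → c ≤ z → z ≤ suc c → Blue z
        blue-c,c+1 = pair-interval blue-c (s≤s z≤n , c+1≤N , blue-c+1)
        aN≤k[c+1] : a * N ≤ k * suc c
        aN≤k[c+1] = ≤-trans aN≤kc+q (≤-trans (+-monoʳ-≤ (k * c) q≤k)
                      (≤-reflexive (trans (+-comm (k * c) k) (sym (*-suc k c)))))

    -- N red: a·N = q·N + N, and N ∈ [p, pt] is a sum of p numbers from [1, t].
    red-N : χ N ≡ R → Sol
    red-N red = solution (recast q+p≡k (+-comm (q * N) N)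
                            (replicateₛ redN q ++ₛ interval-sums 1 t red-run p N (·1≤ (≤N p ap≤kc)) N≤pt))
                         redN
      where
        redN : Red N
        redN = N≥1 , ≤-refl , red

    result : Sol
    result = [ red-c+1 , (λ blue-c+1 → [ red-N , blue-N blue-c+1 ]′ (colour N)) ]′ (colour (suc c))

  -- Case B′: c = 2 and 2 is blue.  Then q = 2, k = 6, N = 4, and
  -- 3·4 = 6·2 (all blue) = 2·4 + 4·1 (all red).
  blueTwo-c≡2 : c ≡ 2 → χ 2 ≡ not R → Sol
  blueTwo-c≡2 c≡2 blue-2 = [ red-N , blue-N ]′ (colour N)
    where
      q≡2 : q ≡ 2
      q≡2 = ≤-antisym (subst (q ≤_) c≡2 q≤c) q≥2
      k≡6 : k ≡ 6
      k≡6 = ≤-antisym (subst₂ (λ q c → k ≤ suc q * c) q≡2 c≡2 k≤ac)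
                      (subst (λ q → suc q * q ≤ k) q≡2 aq≤k)
      N≡4 : N ≡ 4
      N≡4 = trans (cong (λ x → ceilDiv (k * x) a) c≡2)
                  (cong₂ (λ k q → ceilDiv (k * 2) (suc q)) k≡6 q≡2)
      aN≡12 : a * N ≡ 12
      aN≡12 = cong₂ (λ q n → suc q * n) q≡2 N≡4
      blue-N : χ N ≡ not R → Sol
      blue-N blue = solution (recast refl (trans (cong (_* 2) k≡6) (sym aN≡12))
                                      (replicateₛ (s≤s z≤n , N≥2 , blue-2) k))
                             (N≥1 , ≤-refl , blue)
      red-N : χ N ≡ R → Sol
      red-N red = solution (recast q+p≡k qN+p≡aN (replicateₛ redN q ++ₛ replicateₛ red1 p)) redN
        where
          redN : Red N
          redN = N≥1 , ≤-refl , red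
          qN+p≡aN : q * N + p * 1 ≡ a * N
          qN+p≡aN = trans (cong₂ _+_ (cong₂ _*_ q≡2 N≡4) (cong (_* 1) (cong₂ _∸_ k≡6 q≡2))) (sym aN≡12)

  -- With d = p - 1 and
  -- i = ⌈d/(X-1)⌉ ≤ a we split a·X = (a - i)·X + i·X, where i·X lies in
  -- [d + i, 2(d + i)] and so is a sum of d + i numbers from {1, 2}; there are
  -- (a - i) + (d + i) = a + d = k terms in total.
  redBelowP : Red 2 → ∀ X → Red X → c ≤ X → X < p → Sol
  redBelowP _ 0 _ c≤0 _ = ⊥-elim (1+n≰n (≤-trans c≥1 c≤0))
  redBelowP _ 1 _ c≤1 _ = ⊥-elim (1+n≰n (≤-trans c≥2 c≤1))
  redBelowP red2 X@(suc (suc X₂)) redX c≤X X<p =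
    solution (recast terms≡k sum≡aX
               (replicateₛ redX (a ∸ i) ++ₛ interval-sums 1 2 (pair-interval red1 red2) (d + i) (i * X) lo hi))
             redX
    where
      d i : ℕ
      d = p ∸ 1
      i = ceilDiv d (suc X₂)
      a+d≡k : a + d ≡ k
      a+d≡k = trans (sym (+-suc q d)) (trans (cong (q +_) (m+[n∸m]≡n (≤-trans (s≤s z≤n) X<p))) q+p≡k)
      X₂≤d : X₂ ≤ d
      X₂≤d = ≤-trans (n≤1+n X₂) (≤-trans (n≤1+n (suc X₂)) (∸-lower 1 X p X<p))
      -- a + d = k ≤ a·c ≤ a·X = a + (X - 1)·a
      d≤[X-1]a : d ≤ suc X₂ * a
      d≤[X-1]a = +-cancelˡ-≤ a d (suc X₂ * a)
                   (subst₂ _≤_ (sym a+d≡k) (trans (*-suc a (suc X₂)) (cong (a +_) (*-comm a (suc X₂))))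
                     (≤-trans k≤ac (*-monoʳ-≤ a c≤X)))
      i≤a : i ≤ a
      i≤a = cancel-with-slack X₂ i a (≤-trans (ceilDiv-upper d X₂) (+-monoˡ-≤ X₂ d≤[X-1]a))
      terms≡k : (a ∸ i) + (d + i) ≡ k
      terms≡k = trans (rearrange (a ∸ i) d i) (trans (cong (_+ d) (m∸n+n≡m i≤a)) a+d≡k)
        where
          rearrange : ∀ x d i → x + (d + i) ≡ (x + i) + d
          rearrange = solve-∀
      sum≡aX : (a ∸ i) * X + i * X ≡ a * X
      sum≡aX = trans (sym (*-distribʳ-+ X (a ∸ i) i)) (cong (_* X) (m∸n+n≡m i≤a))
      iX≡ : ∀ X₂ i → i * suc (suc X₂) ≡ suc X₂ * i + i
      iX≡ = solve-∀
      lo : (d + i) * 1 ≤ i * X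
      lo = ·1≤ (≤-trans (+-monoˡ-≤ i (ceilDiv-lower d X₂)) (≤-reflexive (sym (iX≡ X₂ i))))
      hi : i * X ≤ (d + i) * 2
      hi = begin
        i * X                ≡⟨ iX≡ X₂ i ⟩
        suc X₂ * i + i       ≤⟨ +-monoˡ-≤ i (≤-trans (ceilDiv-upper d X₂) (+-monoʳ-≤ d X₂≤d)) ⟩
        d + d + i            ≤⟨ m≤m+n (d + d + i) i ⟩
        d + d + i + i        ≡⟨ regroup d i ⟩
        (d + i) * 2          ∎
        where
          open ≤-Reasoning
          regroup : ∀ d i → d + d + i + i ≡ (d + i) * 2
          regroup = solve-∀

  module FirstBlueBelowC (t : ℕ) (t≥2 : 2 ≤ t) (t+2≤c : suc (suc t) ≤ c) (run : InitialRed t)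
                         (blue-t+1 : χ (suc t) ≡ not R) where

    s k₁ : ℕ
    s = suc t
    k₁ = k ∸ 1

    k₁+1≡k : suc k₁ ≡ k
    k₁+1≡k = m+[n∸m]≡n (≤-trans (s≤s z≤n) a≤k)

    a≤k₁ : suc q ≤ k₁
    a≤k₁ = ≤-trans (+-monoˡ-≤ q (≤-trans (s≤s z≤n) q≥2))
                   (≤-pred (subst₂ _≤_ (+-suc q q) (sym k₁+1≡k) q+a≤k))

    s≤N : s ≤ N
    s≤N = ≤-trans (≤-trans (n≤1+n s) t+2≤c) c≤N

    blue-s : Blue s
    blue-s = s≤s z≤n , s≤N , blue-t+1

    red-run : ∀ z → 1 ≤ z → z ≤ t → Red z
    red-run = run-red run (≤-trans (n≤1+n t) s≤N)

    -- A red X ∈ [c, N] with X ≤ p·t: for X ≥ p write a·X = q·X + X with X a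
    -- sum of p numbers from the red run [1, t]; for X < p use redBelowP.
    redAnchor : ∀ X → Red X → c ≤ X → X ≤ p * t → Sol
    redAnchor X redX c≤X X≤pt with p ≤? X
    ... | no p≰X = redBelowP (red-run 2 (s≤s z≤n) t≥2) X redX c≤X (≰⇒> p≰X)
    ... | yes p≤X = solution (recast q+p≡k (+-comm (q * X) X)
                                     (replicateₛ redX q ++ₛ interval-sums 1 t red-run p X (·1≤ p≤X) X≤pt))
                             redX

    W Y z : ℕ
    W = k₁ * s + c
    Y = ceilDiv W a
    z = a * Y ∸ k₁ * s

    z+k₁s≡aY : z + k₁ * s ≡ a * Y
    z+k₁s≡aY = m∸n+n≡m (≤-trans (m≤m+n (k₁ * s) c) (ceilDiv-lower W q))

    c≤z : c ≤ z
    c≤z = ∸-lower (k₁ * s) c (a * Y) (ceilDiv-lower W q)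

    z≤c+q : z ≤ c + q
    z≤c+q = ∸-upper (a * Y) (k₁ * s) (c + q)
              (≤-trans (ceilDiv-upper W q) (≤-reflexive (+-assoc (k₁ * s) c q)))

    c≤Y : c ≤ Y
    c≤Y = *-cancelˡ-≤ a (begin
      a * c          ≤⟨ ac≤k+q ⟩
      k + q          ≡⟨ cong (_+ q) (sym k₁+1≡k) ⟩
      suc k₁ + q     ≡⟨ +-suc k₁ q ⟨
      k₁ + suc q     ≤⟨ +-monoʳ-≤ k₁ (≤-trans a≤k₁ (m≤n+m k₁ k₁)) ⟩
      k₁ + (k₁ + k₁) ≡⟨ triple k₁ ⟩
      k₁ * 3         ≤⟨ *-monoʳ-≤ k₁ (s≤s t≥2) ⟩
      k₁ * s         ≤⟨ m≤m+n (k₁ * s) c ⟩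
      W              ≤⟨ ceilDiv-lower W q ⟩
      a * Y          ∎)
      where
        open ≤-Reasoning
        triple : ∀ k → k + (k + k) ≡ k * 3
        triple = solve-∀

    Y≤N : Y ≤ N
    Y≤N = ≤N Y (begin
      a * Y                 ≤⟨ ceilDiv-upper W q ⟩
      k₁ * s + c + q        ≤⟨ +-monoʳ-≤ (k₁ * s + c) (≤-trans (n≤1+n q) a≤k₁) ⟩
      k₁ * s + c + k₁       ≡⟨ regroup k₁ s c ⟩
      c + k₁ * suc s        ≤⟨ +-monoʳ-≤ c (*-monoʳ-≤ k₁ t+2≤c) ⟩
      c + k₁ * c            ≡⟨ cong (_* c) k₁+1≡k ⟩
      k * c                 ∎)
      where
        open ≤-Reasoning
        regroup : ∀ k₁ s c → k₁ * s + c + k₁ ≡ c + k₁ * suc s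
        regroup = solve-∀

    Y≤pt : Y ≤ p * t
    Y≤pt = *-cancelˡ-≤ a (begin
      a * Y                              ≤⟨ ceilDiv-upper W q ⟩
      k₁ * s + c + q                     ≤⟨ +-monoˡ-≤ q (+-mono-≤ (*-monoˡ-≤ s k₁≤q+p) c≤q+p) ⟩
      (q + p) * suc t + (q + p) + q      ≤⟨ [q+p][1+t]+[q+p]+q≤[1+q]pt q p t q≥2 t≥2 p≥at+1 ⟩
      a * (p * t)                        ∎)
      where
        open ≤-Reasoning
        k₁≤q+p : k₁ ≤ q + p
        k₁≤q+p = subst (k₁ ≤_) (trans k₁+1≡k (sym q+p≡k)) (n≤1+n k₁)
        c≤q+p : c ≤ q + p
        c≤q+p = subst (c ≤_) (sym q+p≡k) c≤k
        -- a·(t + 2) ≤ a·c ≤ k + q = 2q + p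
        p≥at+1 : suc (a * t) ≤ p
        p≥at+1 = ≤-trans (n≤1+n _) (+-cancelˡ-≤ (q + q) _ _ (subst₂ _≤_ (expand q t) (regroup q p)
                   (≤-trans (*-monoʳ-≤ a t+2≤c)
                     (≤-trans ac≤k+q (≤-reflexive (cong (_+ q) (sym q+p≡k)))))))
          where
            expand : ∀ q t → suc q * suc (suc t) ≡ (q + q) + suc (suc (suc q * t))
            expand = solve-∀
            regroup : ∀ q p → q + p + q ≡ (q + q) + p
            regroup = solve-∀

    z≤N : z ≤ N
    z≤N = ≤-trans z≤c+q (≤N (c + q) (begin
      a * (c + q)           ≡⟨ *-distribˡ-+ a c q ⟩
      a * c + a * q         ≤⟨ +-mono-≤ (≤-trans ac≤k+q (+-monoʳ-≤ k q≤k)) aq≤k ⟩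
      k + k + k             ≤⟨ m≤m+n (k + k + k) k ⟩
      k + k + k + k         ≡⟨ quadruple k ⟩
      k * 4                 ≤⟨ *-monoʳ-≤ k (≤-trans (s≤s (s≤s t≥2)) t+2≤c) ⟩
      k * c                 ∎))
      where
        open ≤-Reasoning
        quadruple : ∀ k → k + k + k + k ≡ k * 4
        quadruple = solve-∀

    z≤pt : z ≤ p * t
    z≤pt = ≤-trans z≤c+q (≤-trans c+q≤2p (≤-trans (≤-reflexive (*-comm 2 p)) (*-monoʳ-≤ p t≥2)))
      where
        c+q≤2p : c + q ≤ 2 * p
        c+q≤2p = *-cancelˡ-≤ a (begin
          a * (c + q)           ≡⟨ *-distribˡ-+ a c q ⟩
          a * c + a * q         ≤⟨ +-monoˡ-≤ (a * q) ac≤p+2q ⟩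
          p + 2 * q + a * q     ≤⟨ p+2q+[1+q]q≤[1+q]2p q p q≥2 q²≤p ⟩
          a * (2 * p)           ∎)
          where
            open ≤-Reasoning
            regroup : ∀ q p → q + p + q ≡ p + 2 * q
            regroup = solve-∀
            ac≤p+2q : a * c ≤ p + 2 * q
            ac≤p+2q = ≤-trans ac≤k+q (≤-reflexive (trans (cong (_+ q) (sym q+p≡k)) (regroup q p)))

    -- Y red, or Y blue and z red: redAnchor.  Y and z blue: a·Y = z + (k-1)·s.
    result : Sol
    result = [ (λ red-Y → redAnchor Y (Y≥1 , Y≤N , red-Y) c≤Y Y≤pt) , blue-Y ]′ (colour Y)
      where
        Y≥1 : 1 ≤ Y
        Y≥1 = ≤-trans c≥1 c≤Y
        blue-Y : χ Y ≡ not R → Sol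
        blue-Y blue-y = [ (λ red-z → redAnchor z (z≥1 , z≤N , red-z) c≤z z≤pt) , both-blue ]′ (colour z)
          where
            z≥1 : 1 ≤ z
            z≥1 = ≤-trans c≥1 c≤z
            both-blue : χ z ≡ not R → Sol
            both-blue blue-z = solution (recast k₁+1≡k z+k₁s≡aY
                                          (cons z (z≥1 , z≤N , blue-z) (replicateₛ blue-s k₁)))
                                        (Y≥1 , Y≤N , blue-y)

  -- Case D: 2 is blue and c ≥ 3.  Since 3k ≤ kc every x with a·x ≤ 3k lies in
  -- [1, N]; we distinguish the colours of 3 and 4.
  module SecondIsBlue (blue-2′ : χ 2 ≡ not R) (c≥3 : 3 ≤ c) where

    ≤N₃ : ∀ x → a * x ≤ k * 3 → x ≤ N
    ≤N₃ x ax≤3k = ≤N x (≤-trans ax≤3k (*-monoʳ-≤ k c≥3))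

    positive : ∀ x → 1 ≤ a * x → 1 ≤ x
    positive zero 1≤a0 = ⊥-elim (1+n≰n (subst (1 ≤_) (*-zeroʳ a) 1≤a0))
    positive (suc x) _ = s≤s z≤n

    3≤N : 3 ≤ N
    3≤N = ≤-trans c≥3 c≤N

    2c≤N : 2 * c ≤ N
    2c≤N = ≤N (2 * c) (≤-trans (≤-reflexive (sym (*-assoc a 2 c)))
                                (*-monoˡ-≤ c (≤-trans (*-monoʳ-≤ a q≥2) aq≤k)))

    2c≥1 : 1 ≤ 2 * c
    2c≥1 = ≤-trans c≥1 (m≤m+n c _)

    4≤N : 4 ≤ N
    4≤N = ≤-trans (*-monoʳ-≤ 2 c≥2) 2c≤N

    blue-2 : Blue 2
    blue-2 = s≤s z≤n , N≥2 , blue-2′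

    -- Any blue y with a·y ∈ [2k, 3k] is a solution from
    -- {2, 3}.  This forces L = ⌈2k/a⌉, L + 1 and Y = ⌈(p + qL)/a⌉ to be red, and
    -- then a·Y = p·1 + (a·Y - p) with a·Y - p ∈ [qL, q(L+1)] is red.
    module ThreeBlue (blue-3′ : χ 3 ≡ not R) where

      blue-in-[2k,3k] : ∀ y → 1 ≤ y → k * 2 ≤ a * y → a * y ≤ k * 3 → χ y ≡ not R → Sol
      blue-in-[2k,3k] y 1≤y lo hi blue-y =
        solution (interval-sums 2 3 (pair-interval blue-2 (s≤s z≤n , 3≤N , blue-3′)) k (a * y) lo hi)
                 (1≤y , ≤N₃ y hi , blue-y)

      L Y : ℕ
      L = ceilDiv (k * 2) a
      Y = ceilDiv (p + q * L) a

      2k≤aL : k * 2 ≤ a * L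
      2k≤aL = ceilDiv-lower (k * 2) q

      a[L+1]≤3k : a * suc L ≤ k * 3
      a[L+1]≤3k = begin
        a * suc L           ≡⟨ *-suc a L ⟩
        a + a * L           ≤⟨ +-monoʳ-≤ a (ceilDiv-upper (k * 2) q) ⟩
        a + (k * 2 + q)     ≡⟨ regroup a (k * 2) q ⟩
        k * 2 + (q + a)     ≤⟨ +-monoʳ-≤ (k * 2) q+a≤k ⟩
        k * 2 + k           ≡⟨ triple k ⟩
        k * 3               ∎
        where
          open ≤-Reasoning
          regroup : ∀ a x q → a + (x + q) ≡ x + (q + a)
          regroup = solve-∀
          triple : ∀ k → k * 2 + k ≡ k * 3
          triple = solve-∀

      2k≡2[q+p] : k * 2 ≡ 2 * (q + p)
      2k≡2[q+p] = trans (cong (_* 2) (sym q+p≡k)) (*-comm (q + p) 2)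

      L≤p : L ≤ p
      L≤p = cancel-with-slack q L p (≤-trans (ceilDiv-upper (k * 2) q)
              (+-monoˡ-≤ q (subst (_≤ a * p) (sym 2k≡2[q+p]) (2[q+p]≤[1+q]p q p q≥2 q²≤p))))

      -- a·L = L + q·L ≤ p + q·L ≤ a·Y
      L≤Y : L ≤ Y
      L≤Y = *-cancelˡ-≤ a (≤-trans (+-monoˡ-≤ (q * L) L≤p) (ceilDiv-lower (p + q * L) q))

      aY≤3k : a * Y ≤ k * 3
      aY≤3k = *-cancelˡ-≤ a (begin
        a * (a * Y)                              ≤⟨ *-monoʳ-≤ a (ceilDiv-upper (p + q * L) q) ⟩
        a * (p + q * L + q)                      ≡⟨ expand a p q L ⟩
        a * p + q * (a * L) + a * q              ≤⟨ +-monoˡ-≤ (a * q) (+-monoʳ-≤ (a * p) (*-monoʳ-≤ q aL≤)) ⟩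
        a * p + q * (2 * (q + p) + q) + a * q    ≤⟨ [1+q]p+q[2[q+p]+q]+[1+q]q≤3[1+q][q+p] q p q≥2 q²≤p ⟩
        3 * (a * (q + p))                        ≡⟨ regroup a (q + p) ⟩
        a * ((q + p) * 3)                        ≡⟨ cong (λ x → a * (x * 3)) q+p≡k ⟩
        a * (k * 3)                              ∎)
        where
          open ≤-Reasoning
          aL≤ : a * L ≤ 2 * (q + p) + q
          aL≤ = ≤-trans (ceilDiv-upper (k * 2) q) (≤-reflexive (cong (_+ q) 2k≡2[q+p]))
          expand : ∀ a p q L → a * (p + q * L + q) ≡ a * p + q * (a * L) + a * q
          expand = solve-∀
          regroup : ∀ a x → 3 * (a * x) ≡ a * (x * 3)
          regroup = solve-∀

      L≥1 : 1 ≤ L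
      L≥1 = positive L (≤-trans (≤-trans (≤-trans (s≤s z≤n) a≤k) (m≤m*n k 2)) 2k≤aL)

      L+1≤N : suc L ≤ N
      L+1≤N = ≤N₃ (suc L) a[L+1]≤3k

      all-red : χ L ≡ R → χ (suc L) ≡ R → χ Y ≡ R → Sol
      all-red red-L red-L+1 red-Y =
        solution (recast (trans (+-comm p q) q+p≡k) p+rest≡aY
                   (replicateₛ red1 p ++ₛ interval-sums L (suc L) red-L,L+1 q (a * Y ∸ p) lo hi))
                 (≤-trans L≥1 L≤Y , ≤N₃ Y aY≤3k , red-Y)
        where
          red-L,L+1 : ∀ z → L ≤ z → z ≤ suc L → Red z
          red-L,L+1 = pair-interval (L≥1 , ≤-trans (n≤1+n L) L+1≤N , red-L) (s≤s z≤n , L+1≤N , red-L+1)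
          p≤aY : p ≤ a * Y
          p≤aY = ≤-trans (m≤m+n p (q * L)) (ceilDiv-lower (p + q * L) q)
          p+rest≡aY : p * 1 + (a * Y ∸ p) ≡ a * Y
          p+rest≡aY = trans (cong (_+ (a * Y ∸ p)) (*-identityʳ p)) (m+[n∸m]≡n p≤aY)
          lo : q * L ≤ a * Y ∸ p
          lo = ∸-lower p (q * L) (a * Y) (ceilDiv-lower (p + q * L) q)
          hi : a * Y ∸ p ≤ q * suc L
          hi = ∸-upper (a * Y) p (q * suc L)
                 (≤-trans (ceilDiv-upper (p + q * L) q) (≤-reflexive (regroup p q L)))
            where
              regroup : ∀ p q L → p + q * L + q ≡ p + q * suc L
              regroup = solve-∀

      -- a·L, a·(L+1) and a·Y all lie in [2k, 3k].
      result : Sol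
      result = [ red-L , blue-in-[2k,3k] L L≥1 2k≤aL (≤-trans aL≤a[L+1] a[L+1]≤3k) ]′ (colour L)
        where
          aL≤a[L+1] : a * L ≤ a * suc L
          aL≤a[L+1] = *-monoʳ-≤ a (n≤1+n L)
          red-L : χ L ≡ R → Sol
          red-L red = [ red-L+1 , blue-in-[2k,3k] (suc L) (s≤s z≤n) (≤-trans 2k≤aL aL≤a[L+1]) a[L+1]≤3k ]′
                      (colour (suc L))
            where
              red-L+1 : χ (suc L) ≡ R → Sol
              red-L+1 red′ = [ all-red red red′ , blue-in-[2k,3k] Y (≤-trans L≥1 L≤Y) 2k≤aY aY≤3k ]′ (colour Y)
                where
                  2k≤aY : k * 2 ≤ a * Y
                  2k≤aY = ≤-trans 2k≤aL (*-monoʳ-≤ a L≤Y)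

    -- With r = a·c - k ≤ q we have a·2c = 2k + 2r =
    -- (k - r)·2 + r·4, a blue solution if 2c is blue.  If 2c is red, a·2c is a
    -- red sum of ones and threes (k even), or of 2c, ones and threes (k odd).
    module ThreeRedFourBlue (red-3′ : χ 3 ≡ R) (blue-4′ : χ 4 ≡ not R) where

      r : ℕ
      r = a * c ∸ k

      k+r≡ac : k + r ≡ a * c
      k+r≡ac = m+[n∸m]≡n k≤ac

      r≤q : r ≤ q
      r≤q = +-cancelˡ-≤ k r q (subst (_≤ k + q) (sym k+r≡ac) ac≤k+q)

      a2c≡2k+2r : a * (2 * c) ≡ k + 2 * r + k
      a2c≡2k+2r = trans (regroup a c) (trans (cong (2 *_) (sym k+r≡ac)) (spread k r))
        where
          regroup : ∀ a c → a * (2 * c) ≡ 2 * (a * c)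
          regroup = solve-∀
          spread : ∀ k r → 2 * (k + r) ≡ k + 2 * r + k
          spread = solve-∀

      red-3 : Red 3
      red-3 = s≤s z≤n , 3≤N , red-3′

      blue-2c : χ (2 * c) ≡ not R → Sol
      blue-2c blue = solution (recast (m∸n+n≡m r≤k) sum≡
                                (replicateₛ blue-2 (k ∸ r) ++ₛ replicateₛ (s≤s z≤n , 4≤N , blue-4′) r))
                              (2c≥1 , 2c≤N , blue)
        where
          r≤k : r ≤ k
          r≤k = ≤-trans r≤q q≤k
          sum≡ : (k ∸ r) * 2 + r * 4 ≡ a * (2 * c)
          sum≡ = trans (regroup (k ∸ r) r)
                   (trans (cong (λ x → x + 2 * r + x) (m∸n+n≡m r≤k)) (sym a2c≡2k+2r))
            where
              regroup : ∀ x r → x * 2 + r * 4 ≡ (x + r) + 2 * r + (x + r)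
              regroup = solve-∀

      -- k = 2h: a·2c = k + 2(h + r), ones and threes with h + r ≤ k.
      red-2c-even : Red (2 * c) → ∀ h → k ≡ h + h → Sol
      red-2c-even red-2c h k≡2h = solution (recast refl sum≡ (sums-1-3 red1 red-3 k (h + r) h+r≤k)) red-2c
        where
          h+r≤k : h + r ≤ k
          h+r≤k = subst (h + r ≤_) (sym k≡2h) (+-monoʳ-≤ h (≤-trans r≤q q≤h))
            where
              q≤h : q ≤ h
              q≤h = halve q h (subst (q + q ≤_) k≡2h (≤-trans (+-monoʳ-≤ q (n≤1+n q)) q+a≤k))
          sum≡ : k + 2 * (h + r) ≡ a * (2 * c)
          sum≡ = trans (cong (λ x → x + 2 * (h + r)) k≡2h)
                   (trans (regroup h r) (trans (cong (λ x → x + 2 * r + x) (sym k≡2h)) (sym a2c≡2k+2r)))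
            where
              regroup : ∀ h r → (h + h) + 2 * (h + r) ≡ (h + h) + 2 * r + (h + h)
              regroup = solve-∀

      -- k = 2h + 1: a·2c = 2c + 2h + 2u with u = h + 1 + r - c ≤ 2h.
      red-2c-odd : Red (2 * c) → ∀ h → k ≡ suc (h + h) → Sol
      red-2c-odd red-2c h k≡2h+1 =
        solution (recast (sym k≡2h+1) sum≡ (cons (2 * c) red-2c (sums-1-3 red1 red-3 (h + h) u u≤2h))) red-2c
        where
          -- 2c ≤ 3c ≤ a·c = k + r = 2h + 1 + r ≤ 2(h + 1 + r)
          c≤h+1+r : c ≤ suc h + r
          c≤h+1+r = *-cancelˡ-≤ 2 (begin
            2 * c                    ≤⟨ *-monoˡ-≤ c (≤-trans (n≤1+n 2) (s≤s q≥2)) ⟩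
            a * c                    ≡⟨ sym k+r≡ac ⟩
            k + r                    ≡⟨ cong (_+ r) k≡2h+1 ⟩
            suc (h + h) + r          ≤⟨ m≤m+n _ (suc r) ⟩
            suc (h + h) + r + suc r  ≡⟨ regroup h r ⟩
            2 * (suc h + r)          ∎)
            where
              open ≤-Reasoning
              regroup : ∀ h r → suc (h + h) + r + suc r ≡ 2 * (suc h + r)
              regroup = solve-∀
          u : ℕ
          u = suc h + r ∸ c
          c+u≡ : c + u ≡ suc h + r
          c+u≡ = m+[n∸m]≡n c≤h+1+r
          h≥1 : 1 ≤ h
          h≥1 = halve 1 h (≤-pred (subst (3 ≤_) k≡2h+1 (≤-trans (s≤s q≥2) a≤k)))
          u≤2h : u ≤ h + h
          u≤2h = +-cancelˡ-≤ c u (h + h) (subst (_≤ c + (h + h)) (sym c+u≡)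
                   (≤-trans (+-mono-≤ (+-monoˡ-≤ h h≥1) (≤-trans r≤q q≤c))
                            (≤-reflexive (+-comm (h + h) c))))
          sum≡ : 2 * c + ((h + h) + 2 * u) ≡ a * (2 * c)
          sum≡ = trans (regroup c h u) (trans (cong (λ x → 2 * x + h + h) c+u≡)
                   (trans (regroup′ h r) (trans (cong (λ x → x + 2 * r + x) (sym k≡2h+1)) (sym a2c≡2k+2r))))
            where
              regroup : ∀ c h u → 2 * c + ((h + h) + 2 * u) ≡ 2 * (c + u) + h + h
              regroup = solve-∀
              regroup′ : ∀ h r → 2 * (suc h + r) + h + h ≡ suc (h + h) + 2 * r + suc (h + h)
              regroup′ = solve-∀

      result : Sol
      result = [ red-2c , blue-2c ]′ (colour (2 * c))
        where
          red-2c : χ (2 * c) ≡ R → Sol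
          red-2c red with parity k
          ... | inj₁ (h , k≡2h) = red-2c-even (2c≥1 , 2c≤N , red) h k≡2h
          ... | inj₂ (h , k≡2h+1) = red-2c-odd (2c≥1 , 2c≤N , red) h k≡2h+1

    -- Red sums of k numbers from {1, 3, 4} fill
    -- [k + 2, 3k], so every X with a·X in that range must be blue.  This
    -- applies to Y = ⌈(2(k-1) + c + 1)/a⌉ and to z = a·Y - 2(k-1), and then
    -- a·Y = z + (k-1)·2 is a blue solution.
    module ThreeFourRed (red-3′ : χ 3 ≡ R) (red-4′ : χ 4 ≡ R) where

      red-in-[k+2,3k] : ∀ X → 1 ≤ X → k + 2 ≤ a * X → a * X ≤ k * 3 → χ X ≡ R → Sol
      red-in-[k+2,3k] X 1≤X lo hi red =
        solution (sums-1-3-4 red1 (s≤s z≤n , 3≤N , red-3′) (s≤s z≤n , 4≤N , red-4′) k (a * X) lo hi)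
                 (1≤X , ≤N₃ X hi , red)

      k₁ W Y z : ℕ
      k₁ = k ∸ 1
      W = k₁ * 2 + suc c
      Y = ceilDiv W a
      z = a * Y ∸ k₁ * 2

      k₁+1≡k : suc k₁ ≡ k
      k₁+1≡k = m+[n∸m]≡n (≤-trans (s≤s z≤n) a≤k)

      z+2k₁≡aY : z + k₁ * 2 ≡ a * Y
      z+2k₁≡aY = m∸n+n≡m (≤-trans (m≤m+n (k₁ * 2) (suc c)) (ceilDiv-lower W q))

      c+1≤z : suc c ≤ z
      c+1≤z = ∸-lower (k₁ * 2) (suc c) (a * Y) (ceilDiv-lower W q)

      z≤c+1+q : z ≤ suc c + q
      z≤c+1+q = ∸-upper (a * Y) (k₁ * 2) (suc c + q)
                  (≤-trans (ceilDiv-upper W q) (≤-reflexive (+-assoc (k₁ * 2) (suc c) q)))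

      k+2≤aY : k + 2 ≤ a * Y
      k+2≤aY = begin
        k + 2             ≡⟨ cong (_+ 2) (sym k₁+1≡k) ⟩
        suc k₁ + 2        ≡⟨ regroup k₁ ⟩
        (k₁ + 1) + 2      ≤⟨ +-mono-≤ (+-monoʳ-≤ k₁ k₁≥1) (s≤s c≥1) ⟩
        (k₁ + k₁) + suc c ≡⟨ cong (_+ suc c) (sym (double k₁)) ⟩
        W                 ≤⟨ ceilDiv-lower W q ⟩
        a * Y             ∎
        where
          open ≤-Reasoning
          k₁≥1 : 1 ≤ k₁
          k₁≥1 = ≤-pred (subst (2 ≤_) (sym k₁+1≡k) (≤-trans (s≤s (≤-trans (s≤s z≤n) q≥2)) a≤k))
          regroup : ∀ k₁ → suc k₁ + 2 ≡ (k₁ + 1) + 2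
          regroup = solve-∀
          double : ∀ k₁ → k₁ * 2 ≡ k₁ + k₁
          double = solve-∀

      aY≤3k : a * Y ≤ k * 3
      aY≤3k = begin
        a * Y                   ≤⟨ ceilDiv-upper W q ⟩
        k₁ * 2 + suc c + q      ≡⟨ +-assoc (k₁ * 2) (suc c) q ⟩
        k₁ * 2 + suc (c + q)    ≤⟨ +-monoʳ-≤ (k₁ * 2) (s≤s c+q≤k+1) ⟩
        k₁ * 2 + suc (suc k)    ≡⟨ cong (λ x → k₁ * 2 + suc (suc x)) (sym k₁+1≡k) ⟩
        k₁ * 2 + suc (suc (suc k₁)) ≡⟨ regroup k₁ ⟩
        suc k₁ * 3              ≡⟨ cong (_* 3) k₁+1≡k ⟩
        k * 3                   ∎
        where
          open ≤-Reasoning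
          regroup : ∀ k₁ → k₁ * 2 + suc (suc (suc k₁)) ≡ suc k₁ * 3
          regroup = solve-∀
          -- a·(c + q) ≤ (k + q) + q·a ≤ (k + q + 1) + q·k = a·(k + 1)
          c+q≤k+1 : c + q ≤ suc k
          c+q≤k+1 = *-cancelˡ-≤ a (begin
            a * (c + q)          ≡⟨ *-distribˡ-+ a c q ⟩
            a * c + a * q        ≤⟨ +-mono-≤ ac≤k+q (≤-reflexive (*-comm a q)) ⟩
            k + q + q * a        ≤⟨ +-mono-≤ (+-monoʳ-≤ k (n≤1+n q)) (*-monoʳ-≤ q a≤k) ⟩
            k + suc q + q * k    ≡⟨ regroup′ q k ⟩
            a * suc k            ∎)
            where
              regroup′ : ∀ q k → k + suc q + q * k ≡ suc q * suc k
              regroup′ = solve-∀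

      k+2≤az : k + 2 ≤ a * z
      k+2≤az = begin
        k + 2          ≤⟨ +-monoʳ-≤ k (≤-trans (n≤1+n 2) (s≤s q≥2)) ⟩
        k + a          ≤⟨ +-monoˡ-≤ a k≤ac ⟩
        a * c + a      ≡⟨ +-comm (a * c) a ⟩
        a + a * c      ≡⟨ *-suc a c ⟨
        a * suc c      ≤⟨ *-monoʳ-≤ a c+1≤z ⟩
        a * z          ∎
        where open ≤-Reasoning

      az≤3k : a * z ≤ k * 3
      az≤3k = begin
        a * z                      ≤⟨ *-monoʳ-≤ a z≤c+1+q ⟩
        a * (suc c + q)            ≡⟨ expand a c q ⟩
        a + a * c + a * q          ≤⟨ +-monoˡ-≤ (a * q) (+-monoʳ-≤ a ac≤k+q) ⟩
        a + (k + q) + a * q        ≡⟨ regroup a k q (a * q) ⟩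
        k + ((q + a) + a * q)      ≤⟨ +-monoʳ-≤ k (+-mono-≤ q+a≤k aq≤k) ⟩
        k + (k + k)                ≡⟨ triple k ⟩
        k * 3                      ∎
        where
          open ≤-Reasoning
          expand : ∀ a c q → a * (suc c + q) ≡ a + a * c + a * q
          expand = solve-∀
          regroup : ∀ a k q x → a + (k + q) + x ≡ k + ((q + a) + x)
          regroup = solve-∀
          triple : ∀ k → k + (k + k) ≡ k * 3
          triple = solve-∀

      result : Sol
      result = [ red-in-[k+2,3k] Y Y≥1 k+2≤aY aY≤3k , blue-Y ]′ (colour Y)
        where
          Y≥1 : 1 ≤ Y
          Y≥1 = positive Y (≤-trans (≤-trans (s≤s z≤n) (m≤n+m 2 k)) k+2≤aY)
          z≥1 : 1 ≤ z
          z≥1 = ≤-trans (s≤s z≤n) c+1≤z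
          blue-Y : χ Y ≡ not R → Sol
          blue-Y blue-y = [ red-in-[k+2,3k] z z≥1 k+2≤az az≤3k , both-blue ]′ (colour z)
            where
              both-blue : χ z ≡ not R → Sol
              both-blue blue-z = solution (recast k₁+1≡k z+2k₁≡aY
                                            (cons z (z≥1 , ≤N₃ z az≤3k , blue-z) (replicateₛ blue-2 k₁)))
                                          (Y≥1 , ≤N₃ Y aY≤3k , blue-y)

    result : Sol
    result = [ red-3 , ThreeBlue.result ]′ (colour 3)
      where
        red-3 : χ 3 ≡ R → Sol
        red-3 red = [ ThreeFourRed.result red , ThreeRedFourBlue.result red ]′ (colour 4)

  upperBound : Sol
  upperBound with constant-or-change χ c
  ... | inj₁ run = allRed run
  ... | inj₂ (t , t≥1 , t+1≤c , run , blue-t+1) with m≤n⇒m<n∨m≡n t≥1 | m≤n⇒m<n∨m≡n t+1≤c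
  ...   | inj₁ t≥2 | inj₂ t+1≡c = FirstBlueAtC.result t t≥2 t+1≡c run blue-t+1
  ...   | inj₁ t≥2 | inj₁ t+2≤c = FirstBlueBelowC.result t t≥2 t+2≤c run blue-t+1
  ...   | inj₂ refl | inj₂ 2≡c = blueTwo-c≡2 (sym 2≡c) blue-t+1
  ...   | inj₂ refl | inj₁ 3≤c = SecondIsBlue.result blue-t+1 3≤c

theorem1 : (a m : ℕ) → 3 ≤ a → a * a ∸ a + 1 ≤ m → IsRadoNumber m a (C m a)
theorem1 zero m () _
theorem1 (suc q) m a≥3 m≥a²-a+1 =
  Setting.N≥1 q k q≥2 aq≤k , UpperBound.upperBound q k q≥2 aq≤k , λ n′ _ H → lowerBound q k n′ H
  where
    k : ℕ
    k = m ∸ 1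
    q≥2 : 2 ≤ q
    q≥2 = ≤-pred a≥3
    a²-a≡aq : suc q * suc q ∸ suc q ≡ suc q * q
    a²-a≡aq = trans (cong (_∸ suc q) (*-suc (suc q) q)) (m+n∸m≡n (suc q) (suc q * q))
    aq≤k : suc q * q ≤ k
    aq≤k = ∸-lower 1 (suc q * q) m (subst (_≤ m) (trans (cong (_+ 1) a²-a≡aq) (+-comm (suc q * q) 1)) m≥a²-a+1)
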